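{- Let $H$ be a forest, let $(A,B)$ be a bipartition of $H$ with $|A|=|B|$, and let $n$ be an integer with $0\le n\le |A|$. Then there is a stable set $X$ of $H$ with $|X|=|A|$ and $|X\cap A|=n$. -}

module Defs where

open import Data.Nat using (ℕ; _≤_)
open import Data.Bool using (Bool; true; false)
open import Data.Fin using (Fin)
open import Data.Fin.Subset using (Subset; _∈_; _∉_)
open import Data.List using (List; []; _∷_; _++_; [_]; length)
open import Data.List.Relation.Unary.Linked using (Linked)
open import Data.List.Relation.Unary.Unique.Propositional using (Unique)
open import Data.Product using (Σ; _×_)
open import Data.Sum using (_⊎_)
open import Relation.Binary.PropositionalEquality using (_≡_)
open import Relation.Nullary using (¬_)

record Graph (n : ℕ) : Set where
  field
    adj   : Fin n → Fin n → Bool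
    sym   : ∀ i j → adj i j ≡ adj j i
    irref : ∀ i → adj i i ≡ false

Adj : ∀ {n} → Graph n → Fin n → Fin n → Set
Adj G i j = Graph.adj G i j ≡ true

-- A cycle: distinct vertices x, v₁, …, vₖ with k ≥ 2 (so at least 3 vertices),
-- consecutive ones adjacent, and vₖ adjacent to x.
record Cycle {n : ℕ} (G : Graph n) : Set where
  field
    start    : Fin n
    rest     : List (Fin n)
    long     : 2 ≤ length rest
    distinct : Unique (start ∷ rest)
    closed   : Linked (Adj G) (start ∷ rest ++ [ start ])

Forest : ∀ {n} → Graph n → Set
Forest G = ¬ Cycle G

Stable : ∀ {n} → Graph n → Subset n → Set
Stable G X = ∀ i j → i ∈ X → j ∈ X → ¬ Adj G i j

IsBipartition : ∀ {n} → Graph n → Subset n → Subset n → Set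
IsBipartition {n} G A B =
  (∀ (i : Fin n) → (i ∈ A × i ∉ B) ⊎ (i ∉ A × i ∈ B)) × Stable G A × Stable G B

{-# OPTIONS --safe #-}
-- We prove more: for disjoint stable sets A, B with |A| = |B| = m in a forest, every
-- split a + b = m is realised by a stable X ⊆ A ∪ B with |X ∩ A| = a and |X ∩ B| = b. The forest induced on A ∪ B has a vertex w with at most one neighbour
-- in A ∪ B; by symmetry w ∈ A. Let u ∈ B be that neighbour if it lies in B, and any
-- vertex of B otherwise. If a = 0 take X = B. Otherwise split A - w, B - u as (a - 1, b)
-- and add w: its only possible neighbour u has been removed, so X stays stable.
module Submission where

open import Defs
open import Data.Bool using (true; false)
import Data.Bool as Bool
open import Data.Empty using (⊥-elim)
open import Data.Fin using (Fin; zero; suc)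
open import Data.Fin.Properties using (any?; pigeonhole) renaming (_≟_ to _≟ᶠ_; <-irrefl to <ᶠ-irrefl)
open import Data.Fin.Subset using (Subset; inside; outside; _∈_; _∉_; _⊆_; _∩_; _∪_; ∣_∣; Nonempty)
open import Data.Fin.Subset.Properties using (_∈?_; ∣⊥∣≡0; x∈p∩q⁻; x∈p∪q⁻; x∈p∪q⁺; ∩-idem; ∪-comm; nonempty?; Empty-unique)
open import Data.List using (List; []; _∷_; _++_; [_]; length; lookup)
open import Data.List.Properties using (length-++-≤ʳ)
open import Data.List.Relation.Unary.All using (All; []; _∷_)
import Data.List.Relation.Unary.All as All
open import Data.List.Relation.Unary.All.Properties using (¬Any⇒All¬; ++⁺; ++⁻ˡ; ++⁻ʳ)
open import Data.List.Relation.Unary.AllPairs using (AllPairs; []; _∷_)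
open import Data.List.Relation.Unary.Any using (here; there)
open import Data.List.Relation.Unary.Linked using (Linked; []; [-]; _∷_)
open import Data.List.Relation.Unary.Unique.Propositional using (Unique)
import Data.List.Membership.Propositional as List
open import Data.List.Membership.Propositional.Properties using (∈-∃++; ∈-lookup)
open import Data.Nat using (ℕ; zero; suc; _+_; _∸_; _≤_; s≤s)
open import Data.Nat.Properties using (suc-injective; +-comm; m+[n∸m]≡n; ≮⇒≥; n≮n)
open import Data.Product using (Σ; _×_; _,_; proj₁)
open import Data.Sum using (_⊎_; inj₁; inj₂; [_,_]′)
import Data.Sum as Sum
open import Data.Vec using (_∷_; here; there; _[_]≔_)
open import Data.Vec.Properties using ([]=-injective; []≔-updates)
open import Function using (_∘_; id)
open import Relation.Binary.PropositionalEquality using (_≡_; _≢_; refl; sym; trans; cong; subst; module ≡-Reasoning)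
open import Relation.Nullary using (¬_; Dec; yes; no; _×-dec_; ¬?)
open import Relation.Nullary.Decidable using (decidable-stable)

∈-[]≔⁻ : ∀ {n} {i x : Fin n} {s} (p : Subset n) → i ∈ p [ x ]≔ s → i ≡ x ⊎ i ∈ p
∈-[]≔⁻ {x = zero}  (_ ∷ p) here        = inj₁ refl
∈-[]≔⁻ {x = zero}  (_ ∷ p) (there i∈p) = inj₂ (there i∈p)
∈-[]≔⁻ {x = suc x} (_ ∷ p) here        = inj₂ here
∈-[]≔⁻ {x = suc x} (_ ∷ p) (there i∈)  = Sum.map (cong suc) there (∈-[]≔⁻ p i∈)

x∉p[x]≔outside : ∀ {n} (p : Subset n) x → x ∉ p [ x ]≔ outside
x∉p[x]≔outside p x x∈ with () ← []=-injective x∈ ([]≔-updates p x)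

[]≔outside-⊆ : ∀ {n} (p : Subset n) x → p [ x ]≔ outside ⊆ p
[]≔outside-⊆ p x i∈ with ∈-[]≔⁻ p i∈
... | inj₁ refl = ⊥-elim (x∉p[x]≔outside p x i∈)
... | inj₂ i∈p  = i∈p

∣p[x]≔inside∣ : ∀ {n} (p : Subset n) {x} → x ∉ p → ∣ p [ x ]≔ inside ∣ ≡ suc ∣ p ∣
∣p[x]≔inside∣ (true  ∷ p) {zero}  x∉p = ⊥-elim (x∉p here)
∣p[x]≔inside∣ (false ∷ p) {zero}  x∉p = refl
∣p[x]≔inside∣ (true  ∷ p) {suc x} x∉p = cong suc (∣p[x]≔inside∣ p (x∉p ∘ there))
∣p[x]≔inside∣ (false ∷ p) {suc x} x∉p = ∣p[x]≔inside∣ p (x∉p ∘ there)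

suc∣p[x]≔outside∣ : ∀ {n} (p : Subset n) {x} → x ∈ p → suc ∣ p [ x ]≔ outside ∣ ≡ ∣ p ∣
suc∣p[x]≔outside∣ (true  ∷ p) here       = refl
suc∣p[x]≔outside∣ (true  ∷ p) (there x∈) = cong suc (suc∣p[x]≔outside∣ p x∈)
suc∣p[x]≔outside∣ (false ∷ p) (there x∈) = suc∣p[x]≔outside∣ p x∈

[]≔inside-∩ : ∀ {n} (p : Subset n) {q x} → x ∈ q → (p [ x ]≔ inside) ∩ q ≡ (p ∩ q) [ x ]≔ inside
[]≔inside-∩ (_ ∷ p) here       = refl
[]≔inside-∩ (_ ∷ p) (there x∈) = cong (_ ∷_) ([]≔inside-∩ p x∈)

[]≔inside-∩-∉ : ∀ {n} (p q : Subset n) {x} → x ∉ q → (p [ x ]≔ inside) ∩ q ≡ p ∩ q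
[]≔inside-∩-∉ (true  ∷ p) (false ∷ q) {zero}  x∉q = refl
[]≔inside-∩-∉ (false ∷ p) (false ∷ q) {zero}  x∉q = refl
[]≔inside-∩-∉ (_     ∷ p) (true  ∷ q) {zero}  x∉q = ⊥-elim (x∉q here)
[]≔inside-∩-∉ (_     ∷ p) (_     ∷ q) {suc x} x∉q = cong (_ ∷_) ([]≔inside-∩-∉ p q (x∉q ∘ there))

∩-[]≔outside : ∀ {n} (p q : Subset n) {x} → x ∉ p → p ∩ (q [ x ]≔ outside) ≡ p ∩ q
∩-[]≔outside (false ∷ p) (_ ∷ q) {zero}  x∉p = refl
∩-[]≔outside (true  ∷ p) (_ ∷ q) {zero}  x∉p = ⊥-elim (x∉p here)
∩-[]≔outside (_     ∷ p) (_ ∷ q) {suc x} x∉p = cong (_ ∷_) (∩-[]≔outside p q (x∉p ∘ there))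

∣p∣≡suc⇒Nonempty : ∀ {n} {p : Subset n} {k} → ∣ p ∣ ≡ suc k → Nonempty p
∣p∣≡suc⇒Nonempty {n} {p} ∣p∣≡ with nonempty? p
... | yes ne    = ne
... | no  empty with () ← trans (sym ∣p∣≡) (trans (cong ∣_∣ (Empty-unique empty)) (∣⊥∣≡0 n))

module _ {A : Set} {R : A → A → Set} where

  AllPairs-truncate : ∀ ys {x zs} → AllPairs R (ys ++ x ∷ zs) → AllPairs R (ys ++ [ x ])
  AllPairs-truncate []       _          = [] ∷ []
  AllPairs-truncate (y ∷ ys) (ry ∷ rys) =
    ++⁺ (++⁻ˡ ys ry) (All.head (++⁻ʳ ys ry) ∷ []) ∷ AllPairs-truncate ys rys

  Linked-truncate-snoc : ∀ c ys {x zs y} → Linked R (c ∷ ys ++ x ∷ zs) → R x y →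
                         Linked R ((c ∷ ys ++ [ x ]) ++ [ y ])
  Linked-truncate-snoc c []       (r ∷ _)  rxy = r ∷ rxy ∷ [-]
  Linked-truncate-snoc c (y ∷ ys) (r ∷ rs) rxy = r ∷ Linked-truncate-snoc y ys rs rxy

Unique-lookup-injective : ∀ {A : Set} {xs : List A} → Unique xs →
                          ∀ i j → lookup xs i ≡ lookup xs j → i ≡ j
Unique-lookup-injective (_   ∷ _) zero    zero    _  = refl
Unique-lookup-injective (x∉ ∷ _) zero    (suc j) eq = ⊥-elim (All.lookup x∉ (∈-lookup j) eq)
Unique-lookup-injective (x∉ ∷ _) (suc i) zero    eq = ⊥-elim (All.lookup x∉ (∈-lookup i) (sym eq))
Unique-lookup-injective (_   ∷ u) (suc i) (suc j) eq = cong suc (Unique-lookup-injective u i j eq)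

Unique⇒length≤ : ∀ {n} {xs : List (Fin n)} → Unique xs → length xs ≤ n
Unique⇒length≤ {xs = xs} u = ≮⇒≥ λ n<∣xs∣ →
  let (i , j , i<j , eq) = pigeonhole n<∣xs∣ (lookup xs)
  in  <ᶠ-irrefl (Unique-lookup-injective u i j eq) i<j

module _ {v : ℕ} (H : Graph v) where

  Adj-sym : ∀ {i j} → Adj H i j → Adj H j i
  Adj-sym {i} {j} i~j = trans (Graph.sym H j i) i~j

  Adj-irrefl : ∀ {i} → ¬ Adj H i i
  Adj-irrefl {i} i~i with () ← trans (sym i~i) (Graph.irref H i)

  Adj? : ∀ i j → Dec (Adj H i j)
  Adj? i j = Graph.adj H i j Bool.≟ true

  Stable-⊆ : ∀ {X Y} → Y ⊆ X → Stable H X → Stable H Y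
  Stable-⊆ Y⊆X stable i j i∈Y j∈Y = stable i j (Y⊆X i∈Y) (Y⊆X j∈Y)

  Stable-insert : ∀ {X} w → Stable H X → (∀ {j} → j ∈ X → ¬ Adj H w j) → Stable H (X [ w ]≔ inside)
  Stable-insert {X} w stable w≁X i j i∈ j∈ i~j with ∈-[]≔⁻ X i∈ | ∈-[]≔⁻ X j∈
  ... | inj₁ refl | inj₁ refl = Adj-irrefl i~j
  ... | inj₁ refl | inj₂ j∈X = w≁X j∈X i~j
  ... | inj₂ i∈X  | inj₁ refl = w≁X i∈X (Adj-sym i~j)
  ... | inj₂ i∈X  | inj₂ j∈X = stable i j i∈X j∈X i~j

  -- w has at most one neighbour in W, namely (if any) the witness u.
  Leaf : Subset v → Fin v → Set
  Leaf W w = Σ (Fin v) λ u → ∀ {y} → y ∈ W → Adj H w y → y ≡ u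

  Branching : Subset v → Fin v → Set
  Branching W w = Σ (Fin v) λ x → Σ (Fin v) λ y → x ∈ W × y ∈ W × Adj H w x × Adj H w y × x ≢ y

  Leaf⇒¬Branching : ∀ {W w} → Leaf W w → ¬ Branching W w
  Leaf⇒¬Branching (u , covers) (x , y , x∈W , y∈W , w~x , w~y , x≢y) =
    x≢y (trans (covers x∈W w~x) (sym (covers y∈W w~y)))

  leaf-or-branching : ∀ W w → Leaf W w ⊎ Branching W w
  leaf-or-branching W w with any? (λ x → x ∈? W ×-dec Adj? w x)
  ... | no none = inj₁ (w , λ y∈W w~y → ⊥-elim (none (_ , y∈W , w~y)))
  ... | yes (x , x∈W , w~x) with any? (λ y → y ∈? W ×-dec Adj? w y ×-dec ¬? (y ≟ᶠ x))
  ...   | yes (y , y∈W , w~y , y≢x) = inj₂ (x , y , x∈W , y∈W , w~x , w~y , y≢x ∘ sym)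
  ...   | no none = inj₁ (x , λ {y} y∈W w~y →
            decidable-stable (y ≟ᶠ x) (λ y≢x → none (y , y∈W , w~y , y≢x)))

  leaf? : ∀ W w → Dec (Leaf W w)
  leaf? W w = [ yes , (λ branching → no (λ leaf → Leaf⇒¬Branching leaf branching)) ]′
                (leaf-or-branching W w)

  neighbour-avoiding : ∀ {W w} → Branching W w → ∀ p → Σ (Fin v) λ x → x ∈ W × Adj H w x × x ≢ p
  neighbour-avoiding (x , y , x∈W , y∈W , w~x , w~y , x≢y) p with x ≟ᶠ p
  ... | no  x≢p  = x , x∈W , w~x , x≢p
  ... | yes refl = y , y∈W , w~y , x≢y ∘ sym

  chord⇒cycle : ∀ {h c x t} → Unique (h ∷ c ∷ t) → Linked (Adj H) (h ∷ c ∷ t) →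
                x List.∈ t → Adj H x h → Cycle H
  chord⇒cycle {h} {c} {x} u l x∈t x~h with ∈-∃++ x∈t
  ... | ys , zs , refl = record
    { start    = h
    ; rest     = c ∷ ys ++ [ x ]
    ; long     = s≤s (length-++-≤ʳ [ x ] {ys})
    ; distinct = AllPairs-truncate (h ∷ c ∷ ys) u
    ; closed   = Linked-truncate-snoc h (c ∷ ys) l x~h
    }

  record PathIn (W : Subset v) (k : ℕ) : Set where
    constructor path
    field
      end          : Fin v
      trail        : List (Fin v)
      length-trail : length trail ≡ k
      simple       : Unique (end ∷ trail)
      linked       : Linked (Adj H) (end ∷ trail)
      within       : All (_∈ W) (end ∷ trail)

  -- On a one-vertex path nothing is to be avoided; h itself is never a neighbour of h.
  previous : Fin v → List (Fin v) → Fin v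
  previous h []      = h
  previous _ (c ∷ _) = c

  record BalancedPair (m : ℕ) (A B : Subset v) : Set where
    field
      disjoint : ∀ {i} → i ∈ A → i ∉ B
      stableA  : Stable H A
      stableB  : Stable H B
      ∣A∣≡m    : ∣ A ∣ ≡ m
      ∣B∣≡m    : ∣ B ∣ ≡ m

  BalancedPair-swap : ∀ {m A B} → BalancedPair m A B → BalancedPair m B A
  BalancedPair-swap P = record
    { disjoint = λ i∈B i∈A → disjoint i∈A i∈B
    ; stableA  = stableB
    ; stableB  = stableA
    ; ∣A∣≡m    = ∣B∣≡m
    ; ∣B∣≡m    = ∣A∣≡m
    }
    where open BalancedPair P

  BalancedPair-remove : ∀ {k A B w u} → BalancedPair (suc k) A B → w ∈ A → u ∈ B →
                        BalancedPair k (A [ w ]≔ outside) (B [ u ]≔ outside)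
  BalancedPair-remove {A = A} {B} {w} {u} P w∈A u∈B = record
    { disjoint = λ i∈A' i∈B' → disjoint ([]≔outside-⊆ A w i∈A') ([]≔outside-⊆ B u i∈B')
    ; stableA  = Stable-⊆ ([]≔outside-⊆ A w) stableA
    ; stableB  = Stable-⊆ ([]≔outside-⊆ B u) stableB
    ; ∣A∣≡m    = suc-injective (trans (suc∣p[x]≔outside∣ A w∈A) ∣A∣≡m)
    ; ∣B∣≡m    = suc-injective (trans (suc∣p[x]≔outside∣ B u∈B) ∣B∣≡m)
    }
    where open BalancedPair P

  record StableSplit (A B : Subset v) (a b : ℕ) : Set where
    field
      X         : Subset v
      stable    : Stable H X
      X⊆A∪B     : X ⊆ A ∪ B
      ∣X∣≡a+b   : ∣ X ∣ ≡ a + b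
      ∣X∩A∣≡a   : ∣ X ∩ A ∣ ≡ a
      ∣X∩B∣≡b   : ∣ X ∩ B ∣ ≡ b

  StableSplit-swap : ∀ {A B a b} → StableSplit A B a b → StableSplit B A b a
  StableSplit-swap {A} {B} {a} {b} S = record
    { X       = X
    ; stable  = stable
    ; X⊆A∪B   = λ i∈X → subst (_ ∈_) (∪-comm A B) (X⊆A∪B i∈X)
    ; ∣X∣≡a+b = trans ∣X∣≡a+b (+-comm a b)
    ; ∣X∩A∣≡a = ∣X∩B∣≡b
    ; ∣X∩B∣≡b = ∣X∩A∣≡a
    }
    where open StableSplit S

  StableSplit-side : ∀ {m A B} → BalancedPair m A B → StableSplit A B 0 m
  StableSplit-side {m} {A} {B} P = record
    { X       = B
    ; stable  = stableB
    ; X⊆A∪B   = λ i∈B → x∈p∪q⁺ (inj₂ i∈B)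
    ; ∣X∣≡a+b = ∣B∣≡m
    ; ∣X∩A∣≡a = trans (cong ∣_∣ (Empty-unique B∩A-empty)) (∣⊥∣≡0 v)
    ; ∣X∩B∣≡b = trans (cong ∣_∣ (∩-idem B)) ∣B∣≡m
    }
    where
    open BalancedPair P
    B∩A-empty : ¬ Nonempty (B ∩ A)
    B∩A-empty (i , i∈B∩A) = let (i∈B , i∈A) = x∈p∩q⁻ B A i∈B∩A in disjoint i∈A i∈B

  leaf-partner : ∀ {A B w} → Stable H A → w ∈ A → Nonempty B → Leaf (A ∪ B) w →
                 Σ (Fin v) λ u → u ∈ B × (∀ {y} → y ∈ A ∪ B → Adj H w y → y ≡ u)
  leaf-partner {A} {B} {w} stableA w∈A (b , b∈B) (u , covers) with u ∈? B
  ... | yes u∈B = u , u∈B , covers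
  ... | no  u∉B = b , b∈B , λ y∈A∪B w~y → ⊥-elim (isolated y∈A∪B w~y)
    where
    isolated : ∀ {y} → y ∈ A ∪ B → ¬ Adj H w y
    isolated {y} y∈A∪B w~y with x∈p∪q⁻ A B y∈A∪B
    ... | inj₁ y∈A = stableA w y w∈A y∈A w~y
    ... | inj₂ y∈B = u∉B (subst (_∈ B) (covers y∈A∪B w~y) y∈B)

  StableSplit-insert : ∀ {k A B w u a b} → BalancedPair (suc k) A B → w ∈ A → u ∈ B →
                       (∀ {y} → y ∈ A ∪ B → Adj H w y → y ≡ u) →
                       StableSplit (A [ w ]≔ outside) (B [ u ]≔ outside) a b →
                       StableSplit A B (suc a) b
  StableSplit-insert {A = A} {B} {w} {u} {a} {b} P w∈A u∈B covers S = record
    { X       = X [ w ]≔ inside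
    ; stable  = Stable-insert w stable
                  (λ j∈X w~j → u∉X (subst (_∈ X) (covers (X⊆A∪B′ j∈X) w~j) j∈X))
    ; X⊆A∪B   = λ i∈ → [ (λ { refl → x∈p∪q⁺ (inj₁ w∈A) }) , X⊆A∪B′ ]′ (∈-[]≔⁻ X i∈)
    ; ∣X∣≡a+b = trans (∣p[x]≔inside∣ X w∉X) (cong suc ∣X∣≡a+b)
    ; ∣X∩A∣≡a = begin
        ∣ (X [ w ]≔ inside) ∩ A ∣       ≡⟨ cong ∣_∣ ([]≔inside-∩ X w∈A) ⟩
        ∣ (X ∩ A) [ w ]≔ inside ∣       ≡⟨ ∣p[x]≔inside∣ (X ∩ A) (w∉X ∘ proj₁ ∘ x∈p∩q⁻ X A) ⟩
        suc ∣ X ∩ A ∣                   ≡⟨ cong (suc ∘ ∣_∣) (∩-[]≔outside X A w∉X) ⟨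
        suc ∣ X ∩ (A [ w ]≔ outside) ∣  ≡⟨ cong suc ∣X∩A∣≡a ⟩
        suc a                           ∎
    ; ∣X∩B∣≡b = begin
        ∣ (X [ w ]≔ inside) ∩ B ∣       ≡⟨ cong ∣_∣ ([]≔inside-∩-∉ X B (disjoint w∈A)) ⟩
        ∣ X ∩ B ∣                       ≡⟨ cong ∣_∣ (∩-[]≔outside X B u∉X) ⟨
        ∣ X ∩ (B [ u ]≔ outside) ∣      ≡⟨ ∣X∩B∣≡b ⟩
        b                               ∎
    }
    where
    open ≡-Reasoning
    open BalancedPair P
    open StableSplit S
    X⊆A∪B′ : X ⊆ A ∪ B
    X⊆A∪B′ i∈X with x∈p∪q⁻ _ _ (X⊆A∪B i∈X)
    ... | inj₁ i∈A′ = x∈p∪q⁺ (inj₁ ([]≔outside-⊆ A w i∈A′))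
    ... | inj₂ i∈B′ = x∈p∪q⁺ (inj₂ ([]≔outside-⊆ B u i∈B′))
    w∉X : w ∉ X
    w∉X w∈X with x∈p∪q⁻ _ _ (X⊆A∪B w∈X)
    ... | inj₁ w∈A′ = x∉p[x]≔outside A w w∈A′
    ... | inj₂ w∈B′ = disjoint w∈A ([]≔outside-⊆ B u w∈B′)
    u∉X : u ∉ X
    u∉X u∈X with x∈p∪q⁻ _ _ (X⊆A∪B u∈X)
    ... | inj₁ u∈A′ = disjoint ([]≔outside-⊆ A w u∈A′) u∈B
    ... | inj₂ u∈B′ = x∉p[x]≔outside B u u∈B′

  StableSplit-leaf-step :
    ∀ {k A B w} → (∀ {A′ B′} → BalancedPair k A′ B′ → ∀ a b → a + b ≡ k → StableSplit A′ B′ a b) →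
    BalancedPair (suc k) A B → w ∈ A → Leaf (A ∪ B) w → ∀ a b → a + b ≡ suc k → StableSplit A B a b
  StableSplit-leaf-step split P w∈A leaf zero    _ refl  = StableSplit-side P
  StableSplit-leaf-step split P w∈A leaf (suc a) b a+b≡ with
    leaf-partner (BalancedPair.stableA P) w∈A (∣p∣≡suc⇒Nonempty (BalancedPair.∣B∣≡m P)) leaf
  ... | u , u∈B , covers = StableSplit-insert P w∈A u∈B covers
                             (split (BalancedPair-remove P w∈A u∈B) a b (suc-injective a+b≡))

  module _ (forest : Forest H) where

    next-vertex-fresh : ∀ {h x} t → Unique (h ∷ t) → Linked (Adj H) (h ∷ t) → Adj H h x →
                x ≢ previous h t → ¬ x List.∈ h ∷ t
    next-vertex-fresh t       u l h~x x≢p (here refl)          = Adj-irrefl h~x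
    next-vertex-fresh (c ∷ t) u l h~x x≢c (there (here x≡c))   = x≢c x≡c
    next-vertex-fresh (c ∷ t) u l h~x x≢c (there (there x∈t)) = forest (chord⇒cycle u l x∈t (Adj-sym h~x))

    PathIn-extend : ∀ {W k} → (∀ {w} → w ∈ W → Branching W w) → PathIn W k → PathIn W (suc k)
    PathIn-extend branching (path h t ∣t∣≡k u l within)
      with neighbour-avoiding (branching (All.head within)) (previous h t)
    ... | x , x∈W , h~x , x≢p =
      path x (h ∷ t) (cong suc ∣t∣≡k) (¬Any⇒All¬ (h ∷ t) (next-vertex-fresh t u l h~x x≢p) ∷ u)
           (Adj-sym h~x ∷ l) (x∈W ∷ within)

    -- Without leaves, paths never backtrack and never close up, so they grow beyond v vertices.
    ¬everywhere-branching : ∀ {W} → Nonempty W → ¬ (∀ {w} → w ∈ W → Branching W w)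
    ¬everywhere-branching {W} (w₀ , w₀∈W) branching =
      n≮n v (subst (λ k → suc k ≤ v) length-trail (Unique⇒length≤ simple))
      where
      paths : ∀ k → PathIn W k
      paths zero    = path w₀ [] refl ([] ∷ []) [-] (w₀∈W ∷ [])
      paths (suc k) = PathIn-extend branching (paths k)
      open PathIn (paths v)

    forest⇒leaf : ∀ W → Nonempty W → Σ (Fin v) λ w → w ∈ W × Leaf W w
    forest⇒leaf W nonempty with any? (λ w → w ∈? W ×-dec leaf? W w)
    ... | yes found = found
    ... | no  none  = ⊥-elim (¬everywhere-branching nonempty branching)
      where
      branching : ∀ {w} → w ∈ W → Branching W w
      branching {w} w∈W = [ (λ leaf → ⊥-elim (none (w , w∈W , leaf))) , id ]′ (leaf-or-branching W w)

    stableSplit : ∀ m {A B} → BalancedPair m A B → ∀ a b → a + b ≡ m → StableSplit A B a b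
    stableSplit zero    P zero _ refl = StableSplit-side P
    stableSplit (suc k) {A} {B} P a b a+b≡
      with (i , i∈A) ← ∣p∣≡suc⇒Nonempty (BalancedPair.∣A∣≡m P)
      with forest⇒leaf (A ∪ B) (i , x∈p∪q⁺ (inj₁ i∈A))
    ... | w , w∈A∪B , leaf with x∈p∪q⁻ A B w∈A∪B
    ... | inj₁ w∈A = StableSplit-leaf-step (stableSplit k) P w∈A leaf a b a+b≡
    ... | inj₂ w∈B = StableSplit-swap
            (StableSplit-leaf-step (stableSplit k) (BalancedPair-swap P) w∈B
               (subst (λ W → Leaf W w) (∪-comm A B) leaf) b a (trans (+-comm b a) a+b≡))

mainTheorem6 : ∀ {v : ℕ} (H : Graph v) → Forest H → (A B : Subset v) → IsBipartition H A B → ∣ A ∣ ≡ ∣ B ∣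
                 → (n : ℕ) → n ≤ ∣ A ∣
                 → Σ (Subset v) (λ X → Stable H X × ∣ X ∣ ≡ ∣ A ∣ × ∣ X ∩ A ∣ ≡ n)
mainTheorem6 H forest A B (partition , stableA , stableB) ∣A∣≡∣B∣ n n≤∣A∣ =
  X , stable , trans ∣X∣≡a+b (m+[n∸m]≡n n≤∣A∣) , ∣X∩A∣≡a
  where
  pair : BalancedPair H ∣ A ∣ A B
  pair = record
    { disjoint = λ {i} i∈A i∈B →
        [ (λ (_ , i∉B) → i∉B i∈B) , (λ (i∉A , _) → i∉A i∈A) ]′ (partition i)
    ; stableA  = stableA
    ; stableB  = stableB
    ; ∣A∣≡m    = refl
    ; ∣B∣≡m    = sym ∣A∣≡∣B∣
    }
  open StableSplit (stableSplit H forest ∣ A ∣ pair n (∣ A ∣ ∸ n) (m+[n∸m]≡n n≤∣A∣))
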